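{- Let $p_1<p_2<p_3<p_4<p_5$ be primes with $p_1=3$. Then $\phi\left(\frac{p_1p_2p_3p_4p_5}{p_i}\right)+\phi(p_1p_2p_3p_4)>p_1p_2p_3p_4$ for every $i\in\{1,2,3\}$.
   Context: $\phi$ is Euler's totient function. -}

module Defs where

open import Data.Nat using (ℕ; zero; suc; _+_)
open import Data.Nat.GCD using (gcd)
open import Data.List using (List; filter; length; upTo; map)
open import Relation.Nullary.Decidable using (Dec)
open import Data.Nat using (_≟_)

φ : ℕ → ℕ
φ n = length (filter (λ k → gcd k n ≟ 1) (map suc (upTo n)))

-- Multiplying m by a prime p ∤ m multiplies φ by p − 1: among 1, …, p·m the numbers coprime
-- to m make up p full periods, and they are either coprime to p·m or of the form p·i with i
-- coprime to m. Hence φ(q₁q₂q₃q₄) = (q₁ − 1)(q₂ − 1)(q₃ − 1)(q₄ − 1) for distinct primes, and both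
-- sides of the inequality are products of the numbers pⱼ − 1. As p₂, …, p₅ are odd, consecutive
-- ones differ by at least 2, so p₂ ≥ 5, p₃ ≥ p₂ + 2, …; each case is then a comparison of factors,
-- e.g. 4·p₂·p₃·p₄ ≤ (p₂ − 1)(p₃ − 1)(p₄ − 1)(p₅ − 1) when p₁ is omitted.
module Submission where

open import Defs
open import Data.Nat using (ℕ; _+_; _*_; _<_; _>_)
open import Relation.Binary.PropositionalEquality using (_≡_)
open import Data.Nat.DivMod using (_/_)
open import Data.Nat.Primality using (Prime; prime⇒nonZero)
open import Data.Fin using (Fin; zero; suc; inject≤)
open import Data.Nat using (s≤s; z≤n)

open import Data.Bool using (if_then_else_)
open import Data.List using (List; []; _∷_; [_]; _++_; _∷ʳ_; filter; length; map; upTo)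
open import Data.List.Properties using (upTo-∷ʳ; map-++; filter-++; length-++)
open import Data.List.Relation.Unary.All using (All; []; _∷_)
open import Data.List.Relation.Unary.AllPairs using (AllPairs; []; _∷_)
open import Data.List.Relation.Unary.Linked using (Linked; []; [-]; _∷_)
open import Data.List.Relation.Unary.Linked.Properties using (Linked⇒AllPairs)
open import Data.Nat using (zero; suc; pred; _≤_; _≟_; NonZero; nonTrivial⇒≢1)
open import Data.Nat.GCD using (gcd)
open import Data.Nat.Coprimality as Coprime
  using (Coprime; coprime?; gcd≡1⇒coprime; coprime⇒gcd≡1; coprime-+; coprime-divisor)
open import Data.Nat.Divisibility
  using (_∣_; _∤_; _∣?_; ∣-trans; n∣m*n; m∣m*n; ∣m+n∣m⇒∣n; ∣m∣n⇒∣m+n; ∣⇒≤; ∣1⇒≡1; divides)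
open import Data.Nat.DivMod using (m*n/n≡m)
open import Data.Nat.ListAction using (product)
open import Data.Nat.Primality using (prime⇒irreducible; prime⇒nonTrivial; euclidsLemma)
open import Data.Nat.Properties
open import Algebra.Properties.CommutativeSemigroup +-commutativeSemigroup using (interchange)
open import Data.Nat.Tactic.RingSolver using (solve-∀)
open import Data.Product using (_×_; _,_)
open import Data.Sum using (_⊎_; inj₁; inj₂)
open import Function using (_∘_; _⇔_; mk⇔)
open import Relation.Binary.PropositionalEquality using (_≢_; refl; cong; cong₂; subst; trans; sym; module ≡-Reasoning)
open import Relation.Nullary using (Dec; yes; no; does; ¬_; contradiction)
open import Relation.Nullary.Decidable using (does-⇔; dec-true; dec-false; ¬?; _×-dec_)
open import Relation.Unary using (Decidable)

private
  variable
    k m n p q : ℕ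
    A B : Set

Spaced : List ℕ → Set
Spaced = Linked (λ m n → 2 + m ≤ n)

m*[1+n]<[1+m]*n : m < n → m * suc n < suc m * n
m*[1+n]<[1+m]*n {m} {n} m<n = subst (_< suc m * n) (sym (*-suc m n)) (+-monoˡ-< (m * n) m<n)

-- pred q = φ q for a prime q, so the right-hand sides are φ (P₅ / pᵢ) + φ P₄.
bound-omitting₁ : ∀ {p₁ p₂ p₃ p₄ p₅} → p₁ ≡ 3 → Spaced (p₁ ∷ p₂ ∷ p₃ ∷ p₄ ∷ p₅ ∷ []) →
  p₁ * p₂ * p₃ * p₄ < pred p₂ * pred p₃ * pred p₄ * pred p₅ + pred p₁ * pred p₂ * pred p₃ * pred p₄
bound-omitting₁ {p₂ = suc α} {suc β} {suc γ} {suc δ} refl (s≤s 4≤α ∷ s≤s 2+α≤β ∷ s≤s 2+β≤γ ∷ s≤s 2+γ≤δ ∷ [-]) =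
  begin-strict
    3 * suc α * suc β * suc γ      <⟨ *-monoˡ-< (suc γ) (*-monoˡ-< (suc β) (*-monoˡ-< (suc α) (n<1+n 3))) ⟩
    4 * suc α * suc β * suc γ      ≤⟨ *-mono-≤ (*-mono-≤ (*-mono-≤ 4≤α (<⇒≤ 2+α≤β)) (<⇒≤ 2+β≤γ)) (<⇒≤ 2+γ≤δ) ⟩
    α * β * γ * δ                  ≤⟨ m≤m+n _ _ ⟩
    α * β * γ * δ + 2 * α * β * γ  ∎
  where open ≤-Reasoning

bound-omitting₂ : ∀ {p₁ p₂ p₃ p₄ p₅} → p₁ ≡ 3 → Spaced (p₁ ∷ p₂ ∷ p₃ ∷ p₄ ∷ p₅ ∷ []) →
  p₁ * p₂ * p₃ * p₄ < pred p₁ * pred p₃ * pred p₄ * pred p₅ + pred p₁ * pred p₂ * pred p₃ * pred p₄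
bound-omitting₂ {p₂ = suc α} {suc β} {suc γ} {suc δ} refl (s≤s _ ∷ s≤s 2+α≤β ∷ s≤s 2+β≤γ ∷ s≤s 2+γ≤δ ∷ [-]) =
  begin-strict
    3 * suc α * suc β * suc γ           ≡⟨ regroup α β γ ⟩
    suc α * suc β * (3 * suc γ)         <⟨ *-mono-< (m*[1+n]<[1+m]*n 2+α≤β) (m*[1+n]<[1+m]*n (m+n≤o⇒m≤o 4 4+α≤γ)) ⟩
    (2 + α) * β * (4 * γ)               ≡⟨ expand α β γ ⟩
    2 * β * γ * (4 + α) + 2 * α * β * γ ≤⟨ +-monoˡ-≤ (2 * α * β * γ) (*-monoʳ-≤ (2 * β * γ) 4+α≤δ) ⟩
    2 * β * γ * δ + 2 * α * β * γ       ∎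
  where
  open ≤-Reasoning
  4+α≤γ : 4 + α ≤ γ
  4+α≤γ = ≤-trans (+-monoʳ-≤ 2 2+α≤β) 2+β≤γ
  4+α≤δ : 4 + α ≤ δ
  4+α≤δ = ≤-trans 4+α≤γ (m+n≤o⇒n≤o 2 2+γ≤δ)
  regroup : ∀ a b c → 3 * suc a * suc b * suc c ≡ suc a * suc b * (3 * suc c)
  regroup = solve-∀
  expand : ∀ a b c → (2 + a) * b * (4 * c) ≡ 2 * b * c * (4 + a) + 2 * a * b * c
  expand = solve-∀

bound-omitting₃ : ∀ {p₁ p₂ p₃ p₄ p₅} → p₁ ≡ 3 → Spaced (p₁ ∷ p₂ ∷ p₃ ∷ p₄ ∷ p₅ ∷ []) →
  p₁ * p₂ * p₃ * p₄ < pred p₁ * pred p₂ * pred p₄ * pred p₅ + pred p₁ * pred p₂ * pred p₃ * pred p₄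
bound-omitting₃ {p₂ = suc α} {suc β} {suc γ} {suc δ} refl (s≤s 4≤α ∷ s≤s _ ∷ s≤s 2+β≤γ ∷ s≤s 2+γ≤δ ∷ [-]) =
  begin-strict
    3 * suc α * suc β * suc γ           ≡⟨ *-assoc (3 * suc α) (suc β) (suc γ) ⟩
    3 * suc α * (suc β * suc γ)         <⟨ *-mono-< (m*[1+n]<[1+m]*n 4≤α) (m*[1+n]<[1+m]*n 2+β≤γ) ⟩
    4 * α * ((2 + β) * γ)               ≡⟨ expand α β γ ⟩
    2 * α * γ * (4 + β) + 2 * α * β * γ ≤⟨ +-monoˡ-≤ (2 * α * β * γ) (*-monoʳ-≤ (2 * α * γ) 4+β≤δ) ⟩
    2 * α * γ * δ + 2 * α * β * γ       ∎
  where
  open ≤-Reasoning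
  4+β≤δ : 4 + β ≤ δ
  4+β≤δ = ≤-trans (+-monoʳ-≤ 2 2+β≤γ) 2+γ≤δ
  expand : ∀ a b c → 4 * a * ((2 + b) * c) ≡ 2 * a * c * (4 + b) + 2 * a * b * c
  expand = solve-∀

open ≡-Reasoning

𝟙 : Dec A → ℕ
𝟙 A? = if does A? then 1 else 0

𝟙-⇔ : A ⇔ B → (A? : Dec A) (B? : Dec B) → 𝟙 A? ≡ 𝟙 B?
𝟙-⇔ A⇔B A? B? = cong (λ b → if b then 1 else 0) (does-⇔ A⇔B A? B?)

𝟙-true : (A? : Dec A) → A → 𝟙 A? ≡ 1
𝟙-true A? a = cong (λ b → if b then 1 else 0) (dec-true A? a)

𝟙-false : (A? : Dec A) → ¬ A → 𝟙 A? ≡ 0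
𝟙-false A? ¬a = cong (λ b → if b then 1 else 0) (dec-false A? ¬a)

𝟙-split : (A? : Dec A) (B? : Dec B) → 𝟙 (¬? A? ×-dec B?) + 𝟙 A? * 𝟙 B? ≡ 𝟙 B?
𝟙-split (yes _) (yes _) = refl
𝟙-split (yes _) (no _)  = refl
𝟙-split (no _)  (yes _) = refl
𝟙-split (no _)  (no _)  = refl

∑ : (ℕ → ℕ) → ℕ → ℕ
∑ f zero    = 0
∑ f (suc n) = ∑ f n + f (suc n)

∑-cong : ∀ {f g} → (∀ k → f k ≡ g k) → ∀ n → ∑ f n ≡ ∑ g n
∑-cong f≗g zero    = refl
∑-cong f≗g (suc n) = cong₂ _+_ (∑-cong f≗g n) (f≗g (suc n))

∑-distrib-+ : ∀ f g n → ∑ (λ k → f k + g k) n ≡ ∑ f n + ∑ g n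
∑-distrib-+ f g zero    = refl
∑-distrib-+ f g (suc n) = begin
  ∑ (λ k → f k + g k) n + (f (suc n) + g (suc n)) ≡⟨ cong (_+ (f (suc n) + g (suc n))) (∑-distrib-+ f g n) ⟩
  ∑ f n + ∑ g n + (f (suc n) + g (suc n))         ≡⟨ interchange (∑ f n) (∑ g n) _ _ ⟩
  ∑ f (suc n) + ∑ g (suc n)                       ∎

∑-+ : ∀ f m n → ∑ f (m + n) ≡ ∑ f m + ∑ (λ k → f (m + k)) n
∑-+ f m zero    = trans (cong (∑ f) (+-identityʳ m)) (sym (+-identityʳ _))
∑-+ f m (suc n) = begin
  ∑ f (m + suc n)                                 ≡⟨ cong (∑ f) (+-suc m n) ⟩
  ∑ f (m + n) + f (suc (m + n))                   ≡⟨ cong₂ _+_ (∑-+ f m n) (cong f (sym (+-suc m n))) ⟩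
  ∑ f m + ∑ (λ k → f (m + k)) n + f (m + suc n)   ≡⟨ +-assoc (∑ f m) _ _ ⟩
  ∑ f m + ∑ (λ k → f (m + k)) (suc n)             ∎

∑-periodic : ∀ f m → (∀ k → f (m + k) ≡ f k) → ∀ j → ∑ f (j * m) ≡ j * ∑ f m
∑-periodic f m periodic zero    = refl
∑-periodic f m periodic (suc j) = begin
  ∑ f (m + j * m)                     ≡⟨ ∑-+ f m (j * m) ⟩
  ∑ f m + ∑ (λ k → f (m + k)) (j * m) ≡⟨ cong (∑ f m +_) (∑-cong periodic (j * m)) ⟩
  ∑ f m + ∑ f (j * m)                 ≡⟨ cong (∑ f m +_) (∑-periodic f m periodic j) ⟩
  ∑ f m + j * ∑ f m                   ∎

∑-vanishing : ∀ f n → (∀ {k} → k < n → f (suc k) ≡ 0) → ∑ f n ≡ 0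
∑-vanishing f zero    vanish = refl
∑-vanishing f (suc n) vanish =
  cong₂ _+_ (∑-vanishing f n (vanish ∘ m<n⇒m<1+n)) (vanish (n<1+n n))

∑-multiples : ∀ p .{{_ : NonZero p}} g j →
              ∑ (λ k → 𝟙 (p ∣? k) * g k) (j * p) ≡ ∑ (g ∘ (p *_)) j
∑-multiples p         g zero    = refl
∑-multiples p@(suc q) g (suc j) = begin
  ∑ h (p + j * p)                         ≡⟨ cong (∑ h) (+-comm p (j * p)) ⟩
  ∑ h (j * p + p)                         ≡⟨ ∑-+ h (j * p) p ⟩
  ∑ h (j * p) + ∑ (λ k → h (j * p + k)) p ≡⟨ cong₂ _+_ (∑-multiples p g j) block ⟩
  ∑ (g ∘ (p *_)) (suc j)                  ∎
  where
  h : ℕ → ℕ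
  h k = 𝟙 (p ∣? k) * g k

  [1+j]p≡p[1+j] : j * p + p ≡ p * suc j
  [1+j]p≡p[1+j] = trans (+-comm (j * p) p) (*-comm (suc j) p)

  off-multiples : ∀ {k} → k < q → h (j * p + suc k) ≡ 0
  off-multiples {k} k<q = cong (_* g (j * p + suc k)) (𝟙-false (p ∣? j * p + suc k) p∤)
    where
    p∤ : p ∤ j * p + suc k
    p∤ p∣ = <⇒≱ (s≤s k<q) (∣⇒≤ (∣m+n∣m⇒∣n p∣ (n∣m*n j)))

  block : ∑ (λ k → h (j * p + k)) p ≡ g (p * suc j)
  block = begin
    ∑ (λ k → h (j * p + k)) q + h (j * p + p)
      ≡⟨ cong₂ _+_ (∑-vanishing _ q off-multiples) (cong h [1+j]p≡p[1+j]) ⟩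
    h (p * suc j)
      ≡⟨ cong (_* g (p * suc j)) (𝟙-true (p ∣? p * suc j) (m∣m*n (suc j))) ⟩
    1 * g (p * suc j)
      ≡⟨ *-identityˡ _ ⟩
    g (p * suc j)
      ∎

length-filter≡∑ : ∀ {P : ℕ → Set} (P? : Decidable P) n →
             length (filter P? (map suc (upTo n))) ≡ ∑ (𝟙 ∘ P?) n
length-filter≡∑ P? zero    = refl
length-filter≡∑ P? (suc n) = begin
  length (filter P? (map suc (upTo (suc n))))
    ≡⟨ cong (length ∘ filter P? ∘ map suc) (upTo-∷ʳ n) ⟨
  length (filter P? (map suc (upTo n ∷ʳ n)))
    ≡⟨ cong (length ∘ filter P?) (map-++ suc (upTo n) [ n ]) ⟩
  length (filter P? (map suc (upTo n) ++ [ suc n ]))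
    ≡⟨ cong length (filter-++ P? (map suc (upTo n)) [ suc n ]) ⟩
  length (filter P? (map suc (upTo n)) ++ filter P? [ suc n ])
    ≡⟨ length-++ (filter P? (map suc (upTo n))) ⟩
  length (filter P? (map suc (upTo n))) + length (filter P? [ suc n ])
    ≡⟨ cong₂ _+_ (length-filter≡∑ P? n) (count-singleton (suc n)) ⟩
  ∑ (𝟙 ∘ P?) (suc n)
    ∎
  where
  count-singleton : ∀ x → length (filter P? [ x ]) ≡ 𝟙 (P? x)
  count-singleton x with P? x
  ... | yes _ = refl
  ... | no _  = refl

coprimeTo : ℕ → ℕ → ℕ
coprimeTo n k = 𝟙 (coprime? k n)

φ≡∑coprimeTo : ∀ n → φ n ≡ ∑ (coprimeTo n) n
φ≡∑coprimeTo n = trans (length-filter≡∑ (λ k → gcd k n ≟ 1) n)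
  (∑-cong (λ k → 𝟙-⇔ (mk⇔ gcd≡1⇒coprime coprime⇒gcd≡1) (gcd k n ≟ 1) (coprime? k n)) n)

prime≢1 : Prime p → p ≢ 1
prime≢1 pp = nonTrivial⇒≢1 {{prime⇒nonTrivial pp}}

prime∤⇒coprime : Prime p → p ∤ m → Coprime p m
prime∤⇒coprime pp p∤m (d∣p , d∣m) with prime⇒irreducible pp d∣p
... | inj₁ d≡1    = d≡1
... | inj₂ refl   = contradiction d∣m p∤m

coprime-+-self : Coprime (m + k) m ⇔ Coprime k m
coprime-+-self = mk⇔ (λ c {_} (d∣k , d∣m) → c (∣m∣n⇒∣m+n d∣m d∣k , d∣m)) coprime-+

coprime-*ˡ : Coprime p m → Coprime (p * k) m ⇔ Coprime k m
coprime-*ˡ {p} {m} {k} p⊥m = mk⇔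
  (λ c {_} (d∣k , d∣m) → c (∣-trans d∣k (n∣m*n p) , d∣m))
  (λ c {d} (d∣pk , d∣m) → c (coprime-divisor (d⊥p d∣m) d∣pk , d∣m))
  where
  d⊥p : ∀ {d} → d ∣ m → Coprime d p
  d⊥p d∣m = Coprime.sym λ {_} (e∣p , e∣d) → p⊥m (e∣p , ∣-trans e∣d d∣m)

coprime-prime-* : Prime p → Coprime k (p * m) ⇔ (p ∤ k × Coprime k m)
coprime-prime-* {p} {k} {m} pp = mk⇔
  (λ c → (λ p∣k → prime≢1 pp (c (p∣k , m∣m*n m)))
        , (λ {_} (d∣k , d∣m) → c (d∣k , ∣-trans d∣m (n∣m*n p))))
  (λ (p∤k , c) {d} (d∣k , d∣pm) → c (d∣k , coprime-divisor (d⊥p p∤k d∣k) d∣pm))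
  where
  d⊥p : ∀ {d} → p ∤ k → d ∣ k → Coprime d p
  d⊥p p∤k d∣k = Coprime.sym (prime∤⇒coprime pp (λ p∣d → p∤k (∣-trans p∣d d∣k)))

coprimeTo-prime-* : Prime p → ∀ k → coprimeTo (p * m) k + 𝟙 (p ∣? k) * coprimeTo m k ≡ coprimeTo m k
coprimeTo-prime-* {p} {m} pp k = begin
  coprimeTo (p * m) k + 𝟙 (p ∣? k) * coprimeTo m k
    ≡⟨ cong (_+ 𝟙 (p ∣? k) * coprimeTo m k)
            (𝟙-⇔ (coprime-prime-* pp) (coprime? k (p * m)) (¬? (p ∣? k) ×-dec coprime? k m)) ⟩
  𝟙 (¬? (p ∣? k) ×-dec coprime? k m) + 𝟙 (p ∣? k) * coprimeTo m k
    ≡⟨ 𝟙-split (p ∣? k) (coprime? k m) ⟩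
  coprimeTo m k
    ∎

φ[p*m]+φ[m] : Prime p → p ∤ m → φ (p * m) + φ m ≡ p * φ m
φ[p*m]+φ[m] {p} {m} pp p∤m = begin
  φ (p * m) + φ m
    ≡⟨ cong₂ _+_ (φ≡∑coprimeTo (p * m)) (sym multiples) ⟩
  ∑ (coprimeTo (p * m)) (p * m) + ∑ (λ k → 𝟙 (p ∣? k) * coprimeTo m k) (p * m)
    ≡⟨ ∑-distrib-+ _ _ (p * m) ⟨
  ∑ (λ k → coprimeTo (p * m) k + 𝟙 (p ∣? k) * coprimeTo m k) (p * m)
    ≡⟨ ∑-cong (coprimeTo-prime-* pp) (p * m) ⟩
  ∑ (coprimeTo m) (p * m)
    ≡⟨ ∑-periodic (coprimeTo m) m (λ k → 𝟙-⇔ coprime-+-self (coprime? (m + k) m) (coprime? k m)) p ⟩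
  p * ∑ (coprimeTo m) m
    ≡⟨ cong (p *_) (φ≡∑coprimeTo m) ⟨
  p * φ m
    ∎
  where
  instance
    p≢0 : NonZero p
    p≢0 = prime⇒nonZero pp

  p*-preserves : ∀ {i} → Coprime (p * i) m ⇔ Coprime i m
  p*-preserves = coprime-*ˡ (prime∤⇒coprime pp p∤m)

  multiples : ∑ (λ k → 𝟙 (p ∣? k) * coprimeTo m k) (p * m) ≡ φ m
  multiples = begin
    ∑ (λ k → 𝟙 (p ∣? k) * coprimeTo m k) (p * m)
      ≡⟨ cong (∑ _) (*-comm p m) ⟩
    ∑ (λ k → 𝟙 (p ∣? k) * coprimeTo m k) (m * p)
      ≡⟨ ∑-multiples p (coprimeTo m) m ⟩
    ∑ (coprimeTo m ∘ (p *_)) m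
      ≡⟨ ∑-cong (λ i → 𝟙-⇔ p*-preserves (coprime? (p * i) m) (coprime? i m)) m ⟩
    ∑ (coprimeTo m) m
      ≡⟨ φ≡∑coprimeTo m ⟨
    φ m
      ∎

φ-prime-* : Prime p → p ∤ m → φ (p * m) ≡ pred p * φ m
φ-prime-* {p} {m} pp p∤m = +-cancelʳ-≡ (φ m) _ _ (begin
  φ (p * m) + φ m         ≡⟨ φ[p*m]+φ[m] pp p∤m ⟩
  p * φ m                 ≡⟨ cong (_* φ m) (suc-pred p {{prime⇒nonZero pp}}) ⟨
  φ m + pred p * φ m      ≡⟨ +-comm (φ m) _ ⟩
  pred p * φ m + φ m      ∎)

prime∤product : Prime p → ∀ {qs} → All Prime qs → All (p <_) qs → p ∤ product qs
prime∤product pp []         []           p∣1      = prime≢1 pp (∣1⇒≡1 p∣1)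
prime∤product pp (pq ∷ pqs) (p<q ∷ p<qs) p∣q*qs with euclidsLemma _ _ pp p∣q*qs
... | inj₂ p∣qs = prime∤product pp pqs p<qs p∣qs
... | inj₁ p∣q  with prime⇒irreducible pq p∣q
...   | inj₁ p≡1 = prime≢1 pp p≡1
...   | inj₂ p≡q = <⇒≢ p<q p≡q

φ-product : ∀ {ps} → All Prime ps → AllPairs _<_ ps → φ (product ps) ≡ product (map pred ps)
φ-product {[]}     []         []            = refl
φ-product {p ∷ ps} (pp ∷ pps) (p<ps ∷ <-ps) =
  trans (φ-prime-* pp (prime∤product pp pps p<ps)) (cong (pred p *_) (φ-product pps <-ps))

product₄ : ∀ a b c d → product (a ∷ b ∷ c ∷ d ∷ []) ≡ a * b * c * d
product₄ a b c d = begin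
  a * (b * (c * (d * 1))) ≡⟨ cong (λ x → a * (b * (c * x))) (*-identityʳ d) ⟩
  a * (b * (c * d))       ≡⟨ *-assoc a b (c * d) ⟨
  a * b * (c * d)         ≡⟨ *-assoc (a * b) c d ⟨
  a * b * c * d           ∎

φ-product₄ : ∀ {a b c d} → All Prime (a ∷ b ∷ c ∷ d ∷ []) → Linked _<_ (a ∷ b ∷ c ∷ d ∷ []) →
             φ (a * b * c * d) ≡ pred a * pred b * pred c * pred d
φ-product₄ {a} {b} {c} {d} primes increasing = begin
  φ (a * b * c * d)                              ≡⟨ cong φ (product₄ a b c d) ⟨
  φ (product (a ∷ b ∷ c ∷ d ∷ []))               ≡⟨ φ-product primes (Linked⇒AllPairs <-trans increasing) ⟩
  product (map pred (a ∷ b ∷ c ∷ d ∷ []))        ≡⟨ product₄ (pred a) (pred b) (pred c) (pred d) ⟩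
  pred a * pred b * pred c * pred d              ∎

2∣n⊎2∣1+n : ∀ n → 2 ∣ n ⊎ 2 ∣ suc n
2∣n⊎2∣1+n zero    = inj₁ (divides 0 refl)
2∣n⊎2∣1+n (suc n) with 2∣n⊎2∣1+n n
... | inj₁ 2∣n   = inj₂ (∣m∣n⇒∣m+n (divides 1 refl) 2∣n)
... | inj₂ 2∣1+n = inj₁ 2∣1+n

even-prime≡2 : Prime p → 2 ∣ p → p ≡ 2
even-prime≡2 pp 2∣p with prime⇒irreducible pp 2∣p
... | inj₂ 2≡p = sym 2≡p

odd-prime-gap : Prime p → Prime q → 2 < p → p < q → 2 + p ≤ q
odd-prime-gap {p} pp pq 2<p p<q with m≤n⇒m<n∨m≡n p<q
... | inj₁ 1+p<q = 1+p<q
... | inj₂ refl with 2∣n⊎2∣1+n p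
...   | inj₁ 2∣p   = contradiction (even-prime≡2 pp 2∣p) (>⇒≢ 2<p)
...   | inj₂ 2∣1+p = contradiction (even-prime≡2 pq 2∣1+p) (>⇒≢ (m<n⇒m<1+n 2<p))

odd-primes-spaced : ∀ {ps} → 2 < p → All Prime (p ∷ ps) → Linked _<_ (p ∷ ps) → Spaced (p ∷ ps)
odd-primes-spaced 2<p (pp ∷ [])         [-]              = [-]
odd-primes-spaced 2<p (pp ∷ pq ∷ primes) (p<q ∷ increasing) =
  odd-prime-gap pp pq 2<p p<q ∷ odd-primes-spaced (<-trans 2<p p<q) (pq ∷ primes) increasing

φ-cofactor₄ : ∀ {m a b c d x} .{{_ : NonZero x}} → m ≡ a * b * c * d * x →
              All Prime (a ∷ b ∷ c ∷ d ∷ []) → Linked _<_ (a ∷ b ∷ c ∷ d ∷ []) →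
              φ (m / x) ≡ pred a * pred b * pred c * pred d
φ-cofactor₄ {a = a} {b} {c} {d} {x} m≡abcd*x primes increasing =
  trans (cong φ (trans (cong (_/ x) m≡abcd*x) (m*n/n≡m (a * b * c * d) x))) (φ-product₄ primes increasing)

lemma7p5 : (p : Fin 5 → ℕ) → (prime : (j : Fin 5) → Prime (p j)) →
  p zero ≡ 3 →
  p zero < p (suc zero) → p (suc zero) < p (suc (suc zero)) →
  p (suc (suc zero)) < p (suc (suc (suc zero))) →
  p (suc (suc (suc zero))) < p (suc (suc (suc (suc zero)))) →
  (i : Fin 3) →
  let i' = inject≤ i (s≤s (s≤s (s≤s z≤n)))
      P4 = p zero * p (suc zero) * p (suc (suc zero)) * p (suc (suc (suc zero)))
      P5 = P4 * p (suc (suc (suc (suc zero))))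
  in φ (_/_ P5 (p i') {{prime⇒nonZero (prime i')}}) + φ P4 > P4
lemma7p5 p prime p₁≡3 p₁<p₂ p₂<p₃ p₃<p₄ p₄<p₅ = λ where
    zero → exceeds (P₅ / p₁)
      (φ-cofactor₄ (omit₁ p₁ p₂ p₃ p₄ p₅) primes (p₂<p₃ ∷ p₃<p₄ ∷ p₄<p₅ ∷ [-]))
      (bound-omitting₁ p₁≡3 spaced)
    (suc zero) → exceeds (P₅ / p₂)
      (φ-cofactor₄ (omit₂ p₁ p₂ p₃ p₄ p₅) primes (<-trans p₁<p₂ p₂<p₃ ∷ p₃<p₄ ∷ p₄<p₅ ∷ [-]))
      (bound-omitting₂ p₁≡3 spaced)
    (suc (suc zero)) → exceeds (P₅ / p₃)
      (φ-cofactor₄ (omit₃ p₁ p₂ p₃ p₄ p₅) primes (p₁<p₂ ∷ <-trans p₂<p₃ p₃<p₄ ∷ p₄<p₅ ∷ [-]))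
      (bound-omitting₃ p₁≡3 spaced)
  where
  p₁ p₂ p₃ p₄ p₅ P₄ P₅ : ℕ
  p₁ = p zero
  p₂ = p (suc zero)
  p₃ = p (suc (suc zero))
  p₄ = p (suc (suc (suc zero)))
  p₅ = p (suc (suc (suc (suc zero))))
  P₄ = p₁ * p₂ * p₃ * p₄
  P₅ = P₄ * p₅

  instance
    p≢0 : ∀ {j} → NonZero (p j)
    p≢0 {j} = prime⇒nonZero (prime j)

  primes : ∀ {a b c d} → All Prime (p a ∷ p b ∷ p c ∷ p d ∷ [])
  primes = prime _ ∷ prime _ ∷ prime _ ∷ prime _ ∷ []

  spaced : Spaced (p₁ ∷ p₂ ∷ p₃ ∷ p₄ ∷ p₅ ∷ [])
  spaced = odd-primes-spaced (≤-reflexive (sym p₁≡3)) (prime _ ∷ primes) (p₁<p₂ ∷ p₂<p₃ ∷ p₃<p₄ ∷ p₄<p₅ ∷ [-])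

  exceeds : ∀ {v} m → φ m ≡ v → P₄ < v + pred p₁ * pred p₂ * pred p₃ * pred p₄ → φ m + φ P₄ > P₄
  exceeds m φm≡v = subst (P₄ <_) (sym (cong₂ _+_ φm≡v (φ-product₄ primes (p₁<p₂ ∷ p₂<p₃ ∷ p₃<p₄ ∷ [-]))))

  omit₁ : ∀ a b c d e → a * b * c * d * e ≡ b * c * d * e * a
  omit₁ = solve-∀
  omit₂ : ∀ a b c d e → a * b * c * d * e ≡ a * c * d * e * b
  omit₂ = solve-∀
  omit₃ : ∀ a b c d e → a * b * c * d * e ≡ a * b * d * e * c
  omit₃ = solve-∀
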